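{- If $\varphi:\mathbb{N}\to\mathbb{N}$ is a functional closure property of $\#\mathsf{FA}$ and $\psi:\mathbb{N}\to\mathbb{N}$ is an arbitrary function with $\varphi(n)=\psi(n)$ for all but finitely many $n\in\mathbb{N}$, then $\psi$ is also a functional closure property of $\#\mathsf{FA}$.
   Context: $\mathbb{N}=\{0,1,2,\dots\}$. An NFA is a tuple $M=(Q,\Sigma,\mathrm{wt},\mathrm{in},\mathrm{out})$ with $Q,\Sigma$ finite, $\mathrm{wt}:Q\times\Sigma\times Q\to\mathbb{N}$, $\mathrm{in},\mathrm{out}:Q\to\mathbb{N}$; on input $w=w_1\cdots w_n$ it outputs $\sum_{q_0,\dots,q_n\in Q}\mathrm{in}(q_0)\prod_{i=1}^n\mathrm{wt}(q_{i-1},w_i,q_i)\mathrm{out}(q_n)$. $\#\mathsf{FA}$ is the set of functions $\Sigma^\star\to\mathbb{N}$ (over finite alphabets) computed by NFAs. A function $\chi:\mathbb{N}\to\mathbb{N}$ is a functional closure property of $\#\mathsf{FA}$ if for every $f\in\#\mathsf{FA}$, $w\mapsto\chi(f(w))$ is in $\#\mathsf{FA}$. -}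

module Defs where

open import Data.Nat using (ℕ; _+_; _*_; _≥_)
open import Data.Fin using (Fin; zero; suc)
open import Data.List using (List; []; _∷_)
open import Data.Product using (Σ; ∃; _×_; _,_)
open import Relation.Binary.PropositionalEquality using (_≡_)

sum : ∀ {m} → (Fin m → ℕ) → ℕ
sum {ℕ.zero}  f = 0
sum {ℕ.suc m} f = f zero + sum (λ i → f (suc i))

-- A weighted (counting) NFA over the alphabet Fin k with state set Fin m.
-- (Any finite alphabet / finite state set is in bijection with some Fin.)
record NFA (k : ℕ) : Set where
  field
    states : ℕ
    wt     : Fin states → Fin k → Fin states → ℕ
    inW    : Fin states → ℕ
    outW   : Fin states → ℕ
open NFA public

pathSum : ∀ {k} (M : NFA k) → Fin (states M) → List (Fin k) → ℕ
pathSum M q []      = outW M q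
pathSum M q (a ∷ w) = sum (λ q' → wt M q a q' * pathSum M q' w)

-- The function Σ⋆ → ℕ computed by M:
-- Σ_{q₀,…,qₙ} in(q₀) ∏ wt(q_{i-1},w_i,q_i) out(qₙ)
run : ∀ {k} (M : NFA k) → List (Fin k) → ℕ
run M w = sum (λ q₀ → inW M q₀ * pathSum M q₀ w)

InSharpFA : ∀ {k} → (List (Fin k) → ℕ) → Set
InSharpFA {k} f = Σ (NFA k) λ M → ∀ w → run M w ≡ f w

FunctionalClosureProperty : (ℕ → ℕ) → Set
FunctionalClosureProperty χ =
  ∀ (k : ℕ) (f : List (Fin k) → ℕ) → InSharpFA f → InSharpFA (λ w → χ (f w))

AlmostEverywhereEqual : (ℕ → ℕ) → (ℕ → ℕ) → Set
AlmostEverywhereEqual φ ψ = ∃ λ N → ∀ n → n ≥ N → φ n ≡ ψ n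

-- Write ψ n = φ n · [N ≤ n] + [n < N] · ψ n, where both bracketed factors are eventually constant,
-- and use that #FA is closed under products and sums (product and disjoint union of automata).
-- An eventually constant χ is a closure property because χ (f w) only depends on min (f w, N): a
-- deterministic automaton can track the forward weight vector of an NFA for f with every entry
-- capped at N, since n ↦ min (n, N) is compatible with + and *.
module Submission where

open import Defs
open import Algebra.Properties.CommutativeSemigroup using (interchange)
open import Data.Bool.Base using (true; false; if_then_else_)
open import Data.Bool.Properties using (T-≡)
open import Data.Fin.Base using (Fin; zero; suc; toℕ; fromℕ<; splitAt; quotRem; remQuot; quotient; remainder; finToFun; funToFin)
open import Data.Fin.Properties using (toℕ-fromℕ<; finToFun-funToFin)
open import Data.List.Base using (List; []; _∷_; foldl)
open import Data.Nat.Base using (ℕ; zero; suc; _+_; _*_; _^_; _⊓_; _≤_; _≤ᵇ_; s≤s)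
open import Data.Nat.Properties
open import Data.Product.Base as × using (_×_; _,_)
open import Data.Sum.Base as ⊎ using (_⊎_; inj₁; inj₂; [_,_]′)
open import Function.Base using (_∘_)
open import Function.Bundles using (Equivalence)
open import Relation.Nullary.Reflects using (ofʸ; ofⁿ)
open import Relation.Binary.PropositionalEquality
open ≡-Reasoning

open import Algebra.Properties.Semiring.Sum +-*-semiring as ∑
  using (∑-comm; sum-replicate-zero) renaming (sum to ∑)

sum-cong : ∀ {m} {f g : Fin m → ℕ} → (∀ i → f i ≡ g i) → sum f ≡ sum g
sum-cong {zero}  f≗g = refl
sum-cong {suc m} f≗g = cong₂ _+_ (f≗g zero) (sum-cong (f≗g ∘ suc))

sum≡∑ : ∀ {m} (f : Fin m → ℕ) → sum f ≡ ∑ f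
sum≡∑ {zero}  f = refl
sum≡∑ {suc m} f = cong (f zero +_) (sum≡∑ (f ∘ suc))

sum-zero : ∀ m → sum {m} (λ _ → 0) ≡ 0
sum-zero m = trans (sum≡∑ {m} (λ _ → 0)) (sum-replicate-zero m)

*-distribˡ-sum : ∀ {m} c (f : Fin m → ℕ) → c * sum f ≡ sum (λ i → c * f i)
*-distribˡ-sum c f = begin
  c * sum f          ≡⟨ cong (c *_) (sum≡∑ f) ⟩
  c * ∑ f            ≡⟨ ∑.*-distribˡ-sum c f ⟩
  ∑ (λ i → c * f i)  ≡⟨ sum≡∑ (λ i → c * f i) ⟨
  sum (λ i → c * f i) ∎

*-distribʳ-sum : ∀ {m} c (f : Fin m → ℕ) → sum f * c ≡ sum (λ i → f i * c)
*-distribʳ-sum c f = begin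
  sum f * c          ≡⟨ cong (_* c) (sum≡∑ f) ⟩
  ∑ f * c            ≡⟨ ∑.*-distribʳ-sum c f ⟩
  ∑ (λ i → f i * c)  ≡⟨ sum≡∑ (λ i → f i * c) ⟨
  sum (λ i → f i * c) ∎

sum-comm : ∀ {m n} (f : Fin m → Fin n → ℕ) →
           sum (λ i → sum (f i)) ≡ sum (λ j → sum (λ i → f i j))
sum-comm f = begin
  sum (λ i → sum (f i))               ≡⟨ nested f ⟩
  ∑ (λ i → ∑ (f i))                   ≡⟨ ∑-comm f ⟩
  ∑ (λ j → ∑ (λ i → f i j))           ≡⟨ nested (λ j i → f i j) ⟨
  sum (λ j → sum (λ i → f i j))       ∎
  where
  nested : ∀ {m n} (g : Fin m → Fin n → ℕ) → sum (λ i → sum (g i)) ≡ ∑ (λ i → ∑ (g i))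
  nested g = trans (sum-cong (λ i → sum≡∑ (g i))) (sum≡∑ (λ i → ∑ (g i)))

sum-splitAt : ∀ a {b} (F : Fin a ⊎ Fin b → ℕ) →
              sum (F ∘ splitAt a) ≡ sum (F ∘ inj₁) + sum (F ∘ inj₂)
sum-splitAt zero    F = refl
sum-splitAt (suc a) F = trans (cong (F (inj₁ zero) +_) (sum-splitAt a (F ∘ ⊎.map₁ suc)))
                              (sym (+-assoc (F (inj₁ zero)) _ _))

sum-remQuot : ∀ a {b} (F : Fin a × Fin b → ℕ) →
              sum (F ∘ remQuot b) ≡ sum (λ i → sum (λ j → F (i , j)))
sum-remQuot zero    F = refl
sum-remQuot (suc a) {b} F =
  -- on Fin (suc a * b), remQuot b is the following function of splitAt b
  trans (sum-splitAt b (F ∘ ×.swap ∘ [ (_, zero) , ×.map₂ suc ∘ quotRem {a} b ]′))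
        (cong (sum (λ j → F (zero , j)) +_) (sum-remQuot a (F ∘ ×.map₁ suc)))

kronecker : ∀ {m} → Fin m → Fin m → ℕ
kronecker zero    zero    = 1
kronecker zero    (suc j) = 0
kronecker (suc i) zero    = 0
kronecker (suc i) (suc j) = kronecker i j

infix 7 _·_
infixr 8 _⊗ᵛ_ _⊕ᵛ_

_·_ : ∀ {m} → (Fin m → ℕ) → (Fin m → ℕ) → ℕ
u · v = sum (λ i → u i * v i)

·-congˡ : ∀ {m} (u : Fin m → ℕ) {v v′ : Fin m → ℕ} → (∀ i → v i ≡ v′ i) → u · v ≡ u · v′
·-congˡ u v≗v′ = sum-cong (λ i → cong (u i *_) (v≗v′ i))

kronecker-· : ∀ {m} (i : Fin m) (v : Fin m → ℕ) → kronecker i · v ≡ v i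
kronecker-· {suc m} zero    v = trans (cong (v zero + 0 +_) (sum-zero m)) (trans (+-identityʳ _) (+-identityʳ _))
kronecker-· {suc m} (suc i) v = kronecker-· i (v ∘ suc)

_⊗ᵛ_ : ∀ {a b} → (Fin a → ℕ) → (Fin b → ℕ) → Fin (a * b) → ℕ
_⊗ᵛ_ {a} {b} x y p = x (quotient {a} b p) * y (remainder {a} b p)

⊗ᵛ-· : ∀ {a b} (x u : Fin a → ℕ) (y v : Fin b → ℕ) → (x ⊗ᵛ y) · (u ⊗ᵛ v) ≡ (x · u) * (y · v)
⊗ᵛ-· {a} {b} x u y v = begin
  (x ⊗ᵛ y) · (u ⊗ᵛ v)
    ≡⟨ sum-cong (λ p → interchange *-commutativeSemigroup (x (quotient b p)) (y (remainder {a} b p)) _ _) ⟩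
  sum (λ p → (x (quotient b p) * u (quotient b p)) * (y (remainder {a} b p) * v (remainder {a} b p)))
    ≡⟨ sum-remQuot a (λ (i , j) → (x i * u i) * (y j * v j)) ⟩
  sum (λ i → sum (λ j → (x i * u i) * (y j * v j)))
    ≡⟨ sum-cong (λ i → *-distribˡ-sum (x i * u i) (λ j → y j * v j)) ⟨
  sum (λ i → (x i * u i) * (y · v))
    ≡⟨ *-distribʳ-sum (y · v) (λ i → x i * u i) ⟨
  (x · u) * (y · v) ∎

_⊕ᵛ_ : ∀ {a b} → (Fin a → ℕ) → (Fin b → ℕ) → Fin (a + b) → ℕ
_⊕ᵛ_ {a} x y = [ x , y ]′ ∘ splitAt a

⊕ᵛ-· : ∀ {a b} (x u : Fin a → ℕ) (y v : Fin b → ℕ) → (x ⊕ᵛ y) · (u ⊕ᵛ v) ≡ x · u + y · v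
⊕ᵛ-· {a} x u y v = sum-splitAt a (λ s → [ x , y ]′ s * [ u , v ]′ s)

0ᵛ : ∀ {m} → Fin m → ℕ
0ᵛ _ = 0

module _ {k} (M : NFA k) where

  forward : (Fin (states M) → ℕ) → Fin k → Fin (states M) → ℕ
  forward u a q′ = u · (λ q → wt M q a q′)

  runFrom : (Fin (states M) → ℕ) → List (Fin k) → ℕ
  runFrom u w = u · (λ q → pathSum M q w)

  runFrom-∷ : ∀ u a w → runFrom u (a ∷ w) ≡ runFrom (forward u a) w
  runFrom-∷ u a w = begin
    sum (λ q → u q * sum (λ q′ → wt M q a q′ * pathSum M q′ w))
      ≡⟨ sum-cong (λ q → *-distribˡ-sum (u q) (λ q′ → wt M q a q′ * pathSum M q′ w)) ⟩
    sum (λ q → sum (λ q′ → u q * (wt M q a q′ * pathSum M q′ w)))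
      ≡⟨ sum-cong (λ q → sum-cong (λ q′ → *-assoc (u q) (wt M q a q′) (pathSum M q′ w))) ⟨
    sum (λ q → sum (λ q′ → u q * wt M q a q′ * pathSum M q′ w))
      ≡⟨ sum-comm (λ q q′ → u q * wt M q a q′ * pathSum M q′ w) ⟩
    sum (λ q′ → sum (λ q → u q * wt M q a q′ * pathSum M q′ w))
      ≡⟨ sum-cong (λ q′ → *-distribʳ-sum (pathSum M q′ w) (λ q → u q * wt M q a q′)) ⟨
    sum (λ q′ → forward u a q′ * pathSum M q′ w) ∎

InSharpFA-resp-≗ : ∀ {k} {f g : List (Fin k) → ℕ} → (∀ w → f w ≡ g w) → InSharpFA f → InSharpFA g
InSharpFA-resp-≗ f≗g (M , M≗f) = M , λ w → trans (M≗f w) (f≗g w)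

module _ {k s} (δ : Fin s → Fin k → Fin s) (q₀ : Fin s) (out : Fin s → ℕ) where

  deterministic : NFA k
  deterministic = record
    { states = s
    ; wt     = λ q a → kronecker (δ q a)
    ; inW    = kronecker q₀
    ; outW   = out
    }

  pathSum-deterministic : ∀ q w → pathSum deterministic q w ≡ out (foldl δ q w)
  pathSum-deterministic q []      = refl
  pathSum-deterministic q (a ∷ w) =
    trans (·-congˡ (kronecker (δ q a)) (λ q′ → pathSum-deterministic q′ w))
          (kronecker-· (δ q a) (λ q′ → out (foldl δ q′ w)))

  deterministic-InSharpFA : InSharpFA (λ w → out (foldl δ q₀ w))
  deterministic-InSharpFA = deterministic , λ w →
    trans (·-congˡ (kronecker q₀) (λ q → pathSum-deterministic q w))
          (kronecker-· q₀ (λ q → out (foldl δ q w)))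

_⊗_ : ∀ {k} → NFA k → NFA k → NFA k
P ⊗ Q = record
  { states = states P * states Q
  ; wt     = λ p a → wt P (quotient (states Q) p) a ⊗ᵛ wt Q (remainder {states P} (states Q) p) a
  ; inW    = inW P ⊗ᵛ inW Q
  ; outW   = outW P ⊗ᵛ outW Q
  }

_⊕_ : ∀ {k} → NFA k → NFA k → NFA k
P ⊕ Q = record
  { states = states P + states Q
  ; wt     = λ p a → [ (λ i → wt P i a ⊕ᵛ 0ᵛ) , (λ j → 0ᵛ ⊕ᵛ wt Q j a) ]′ (splitAt (states P) p)
  ; inW    = inW P ⊕ᵛ inW Q
  ; outW   = outW P ⊕ᵛ outW Q
  }

module _ {k} (P Q : NFA k) where

  pathSum-⊗ : ∀ p w → pathSum (P ⊗ Q) p w ≡ ((λ i → pathSum P i w) ⊗ᵛ (λ j → pathSum Q j w)) p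
  pathSum-⊗ p []      = refl
  pathSum-⊗ p (a ∷ w) =
    trans (·-congˡ (wt (P ⊗ Q) p a) (λ p′ → pathSum-⊗ p′ w))
          (⊗ᵛ-· (wt P (quotient (states Q) p) a) (λ i → pathSum P i w)
                (wt Q (remainder {states P} (states Q) p) a) (λ j → pathSum Q j w))

  run-⊗ : ∀ w → run (P ⊗ Q) w ≡ run P w * run Q w
  run-⊗ w = trans (·-congˡ (inW (P ⊗ Q)) (λ p → pathSum-⊗ p w))
                  (⊗ᵛ-· (inW P) (λ i → pathSum P i w) (inW Q) (λ j → pathSum Q j w))

  pathSum-⊕ : ∀ p w → pathSum (P ⊕ Q) p w ≡ ((λ i → pathSum P i w) ⊕ᵛ (λ j → pathSum Q j w)) p
  pathSum-⊕ p []      = refl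
  pathSum-⊕ p (a ∷ w) =
    trans (·-congˡ (wt (P ⊕ Q) p a) (λ p′ → pathSum-⊕ p′ w)) (blockRow (splitAt (states P) p))
    where
    blockRow : ∀ s → [ (λ i → wt P i a ⊕ᵛ 0ᵛ) , (λ j → 0ᵛ ⊕ᵛ wt Q j a) ]′ s ·
                       ((λ i → pathSum P i w) ⊕ᵛ (λ j → pathSum Q j w)) ≡
                     [ (λ i → pathSum P i (a ∷ w)) , (λ j → pathSum Q j (a ∷ w)) ]′ s
    blockRow (inj₁ i) = trans (⊕ᵛ-· (wt P i a) (λ i′ → pathSum P i′ w) 0ᵛ (λ j′ → pathSum Q j′ w))
                              (trans (cong (pathSum P i (a ∷ w) +_) (sum-zero (states Q))) (+-identityʳ _))
    blockRow (inj₂ j) = trans (⊕ᵛ-· 0ᵛ (λ i′ → pathSum P i′ w) (wt Q j a) (λ j′ → pathSum Q j′ w))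
                              (cong (_+ pathSum Q j (a ∷ w)) (sum-zero (states P)))

  run-⊕ : ∀ w → run (P ⊕ Q) w ≡ run P w + run Q w
  run-⊕ w = trans (·-congˡ (inW (P ⊕ Q)) (λ p → pathSum-⊕ p w))
                  (⊕ᵛ-· (inW P) (λ i → pathSum P i w) (inW Q) (λ j → pathSum Q j w))

InSharpFA-* : ∀ {k} {f g : List (Fin k) → ℕ} → InSharpFA f → InSharpFA g → InSharpFA (λ w → f w * g w)
InSharpFA-* (P , P≗f) (Q , Q≗g) = P ⊗ Q , λ w → trans (run-⊗ P Q w) (cong₂ _*_ (P≗f w) (Q≗g w))

InSharpFA-+ : ∀ {k} {f g : List (Fin k) → ℕ} → InSharpFA f → InSharpFA g → InSharpFA (λ w → f w + g w)
InSharpFA-+ (P , P≗f) (Q , Q≗g) = P ⊕ Q , λ w → trans (run-⊕ P Q w) (cong₂ _+_ (P≗f w) (Q≗g w))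

module Saturation (N : ℕ) where

  infix 4 _≈_
  _≈_ : ℕ → ℕ → Set
  x ≈ y = x ⊓ N ≡ y ⊓ N

  ⊓-≈ : ∀ x → x ⊓ N ≈ x
  ⊓-≈ x = trans (⊓-assoc x N N) (cong (x ⊓_) (⊓-idem N))

  ⊓-absorbˡ : ∀ x {y} → N ≤ y → (x ⊓ y) ⊓ N ≡ x ⊓ N
  ⊓-absorbˡ x N≤y = trans (⊓-assoc x _ N) (cong (x ⊓_) (m≥n⇒m⊓n≡n N≤y))

  ⊓-+-≈ : ∀ x y → (x ⊓ N) + y ≈ x + y
  ⊓-+-≈ x y = trans (cong (_⊓ N) (+-distribʳ-⊓ y x N)) (⊓-absorbˡ (x + y) (m≤m+n N y))

  ⊓-*-≈ : ∀ x y → (x ⊓ N) * y ≈ x * y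
  ⊓-*-≈ x zero    = cong (_⊓ N) (trans (*-zeroʳ (x ⊓ N)) (sym (*-zeroʳ x)))
  ⊓-*-≈ x (suc y) = trans (cong (_⊓ N) (*-distribʳ-⊓ (suc y) x N)) (⊓-absorbˡ (x * suc y) (m≤m*n N (suc y)))

  congʳ-≈ : (_∙_ : ℕ → ℕ → ℕ) → (∀ x y → (x ⊓ N) ∙ y ≈ x ∙ y) → ∀ {x x′} y → x ≈ x′ → x ∙ y ≈ x′ ∙ y
  congʳ-≈ _∙_ ⊓-∙-≈ {x} {x′} y x≈x′ = begin
    (x ∙ y) ⊓ N          ≡⟨ ⊓-∙-≈ x y ⟨
    ((x ⊓ N) ∙ y) ⊓ N      ≡⟨ cong (λ z → (z ∙ y) ⊓ N) x≈x′ ⟩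
    ((x′ ⊓ N) ∙ y) ⊓ N     ≡⟨ ⊓-∙-≈ x′ y ⟩
    (x′ ∙ y) ⊓ N         ∎

  +-cong-≈ : ∀ {x x′ y y′} → x ≈ x′ → y ≈ y′ → x + y ≈ x′ + y′
  +-cong-≈ {x} {x′} {y} {y′} x≈x′ y≈y′ = begin
    (x + y) ⊓ N    ≡⟨ congʳ-≈ _+_ ⊓-+-≈ y x≈x′ ⟩
    (x′ + y) ⊓ N   ≡⟨ cong (_⊓ N) (+-comm x′ y) ⟩
    (y + x′) ⊓ N   ≡⟨ congʳ-≈ _+_ ⊓-+-≈ x′ y≈y′ ⟩
    (y′ + x′) ⊓ N  ≡⟨ cong (_⊓ N) (+-comm y′ x′) ⟩
    (x′ + y′) ⊓ N  ∎

  sum-cong-≈ : ∀ {m} {f g : Fin m → ℕ} → (∀ i → f i ≈ g i) → sum f ≈ sum g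
  sum-cong-≈ {zero}  f≈g = refl
  sum-cong-≈ {suc m} f≈g = +-cong-≈ (f≈g zero) (sum-cong-≈ (f≈g ∘ suc))

  ·-congʳ-≈ : ∀ {m} {u u′ : Fin m → ℕ} (v : Fin m → ℕ) → (∀ i → u i ≈ u′ i) → u · v ≈ u′ · v
  ·-congʳ-≈ v u≈u′ = sum-cong-≈ (λ i → congʳ-≈ _*_ ⊓-*-≈ (v i) (u≈u′ i))

  saturate : ℕ → Fin (suc N)
  saturate x = fromℕ< (s≤s (m⊓n≤n x N))

  toℕ-saturate : ∀ x → toℕ (saturate x) ≈ x
  toℕ-saturate x = trans (cong (_⊓ N) (toℕ-fromℕ< (s≤s (m⊓n≤n x N)))) (⊓-≈ x)

module CappedRun {k} (M : NFA k) (N : ℕ) where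
  open Saturation N

  -- A configuration encodes a vector of counters in {0, …, N}, one per state of M.
  Config : Set
  Config = Fin (suc N ^ states M)

  counters : Config → Fin (states M) → ℕ
  counters s q = toℕ (finToFun s q)

  encode : (Fin (states M) → ℕ) → Config
  encode u = funToFin (saturate ∘ u)

  counters-encode : ∀ u q → counters (encode u) q ≈ u q
  counters-encode u q = trans (cong (λ c → toℕ c ⊓ N) (finToFun-funToFin (saturate ∘ u) q)) (toℕ-saturate (u q))

  step : Config → Fin k → Config
  step s a = encode (forward M (counters s) a)

  readout : Config → ℕ
  readout s = runFrom M (counters s) [] ⊓ N

  readout-foldl : ∀ w u s → (∀ q → counters s q ≈ u q) → readout (foldl step s w) ≡ runFrom M u w ⊓ N
  readout-foldl []      u s s≈u = ·-congʳ-≈ (outW M) s≈u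
  readout-foldl (a ∷ w) u s s≈u = begin
    readout (foldl step (step s a) w)  ≡⟨ readout-foldl w (forward M u a) (step s a) step≈forward ⟩
    runFrom M (forward M u a) w ⊓ N    ≡⟨ cong (_⊓ N) (runFrom-∷ M u a w) ⟨
    runFrom M u (a ∷ w) ⊓ N            ∎
    where
    step≈forward : ∀ q′ → counters (step s a) q′ ≈ forward M u a q′
    step≈forward q′ = trans (counters-encode _ q′) (·-congʳ-≈ (λ q → wt M q a q′) s≈u)

InSharpFA-⊓ : ∀ {k} {f : List (Fin k) → ℕ} → InSharpFA f → (N : ℕ) (g : ℕ → ℕ) → InSharpFA (λ w → g (f w ⊓ N))
InSharpFA-⊓ (M , M≗f) N g = InSharpFA-resp-≗ readout≗f⊓N (deterministic-InSharpFA step start (g ∘ readout))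
  where
  open CappedRun M N

  start : Config
  start = encode (inW M)

  readout≗f⊓N : ∀ w → g (readout (foldl step start w)) ≡ g (_ ⊓ N)
  readout≗f⊓N w = cong g (trans (readout-foldl w (inW M) start (counters-encode (inW M))) (cong (_⊓ N) (M≗f w)))

closure-eventuallyConstant : ∀ χ N c → (∀ n → N ≤ n → χ n ≡ c) → FunctionalClosureProperty χ
closure-eventuallyConstant χ N c χ≡c k f f∈ = InSharpFA-resp-≗ (sym ∘ χ≡χ∘⊓ ∘ f) (InSharpFA-⊓ f∈ N χ)
  where
  χ≡χ∘⊓ : ∀ n → χ n ≡ χ (n ⊓ N)
  χ≡χ∘⊓ n with ≤-total n N
  ... | inj₁ n≤N = cong χ (sym (m≤n⇒m⊓n≡m n≤N))
  ... | inj₂ N≤n = trans (χ≡c n N≤n) (sym (trans (cong χ (m≥n⇒m⊓n≡n N≤n)) (χ≡c N ≤-refl)))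

lemma18 : (φ ψ : ℕ → ℕ) → FunctionalClosureProperty φ →
          AlmostEverywhereEqual φ ψ → FunctionalClosureProperty ψ
lemma18 φ ψ φ-closure (N , φ≡ψ) k f f∈ =
  InSharpFA-resp-≗ (decomposition ∘ f)
    (InSharpFA-+ (InSharpFA-* (φ-closure k f f∈) (closure-eventuallyConstant atLeastN N 1 atLeastN-constant k f f∈))
                 (closure-eventuallyConstant ψBelowN N 0 ψBelowN-constant k f f∈))
  where
  atLeastN ψBelowN : ℕ → ℕ
  atLeastN n = if N ≤ᵇ n then 1 else 0
  ψBelowN  n = if N ≤ᵇ n then 0 else ψ n

  N≤ᵇ-true : ∀ {n} → N ≤ n → (N ≤ᵇ n) ≡ true
  N≤ᵇ-true N≤n = Equivalence.to T-≡ (≤⇒≤ᵇ N≤n)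

  atLeastN-constant : ∀ n → N ≤ n → atLeastN n ≡ 1
  atLeastN-constant n N≤n = cong (λ b → if b then 1 else 0) (N≤ᵇ-true N≤n)

  ψBelowN-constant : ∀ n → N ≤ n → ψBelowN n ≡ 0
  ψBelowN-constant n N≤n = cong (λ b → if b then 0 else ψ n) (N≤ᵇ-true N≤n)

  decomposition : ∀ n → φ n * atLeastN n + ψBelowN n ≡ ψ n
  decomposition n with N ≤ᵇ n | ≤ᵇ-reflects-≤ N n
  ... | true  | ofʸ N≤n = trans (+-identityʳ _) (trans (*-identityʳ (φ n)) (φ≡ψ n N≤n))
  ... | false | ofⁿ _   = cong (_+ ψ n) (*-zeroʳ (φ n))
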